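{- For every SPS $s$, $\#\lfloor s\rfloor=O(\#s\cdot N_s)$, where $\#x$ denotes the size (number of symbols) of $x$ and $N_s$ denotes the largest natural number occurring in $s$.
   Context: Schemata: $s::=\top\mid p_e\mid\neg s\mid s\wedge s\mid\bigwedge_{\mathsf i=0}^{\mathsf n-1}s$ with Presburger indices and single parameter $\mathsf n$. An SPS is a schema with no nested iterations, indices outside iterations of the form $k$ or $\mathsf n+k$, and indices inside an iteration $\bigwedge_{\mathsf i=0}^{\mathsf n-1}$ of the form $\mathsf i+k$ ($k\in\mathbb N$). LTL formulae are built from $\top$, propositional variables, $\neg,\wedge,X,U$; $G\phi:=\neg(\top U\neg\phi)$; $X^k\phi$ is $\phi$ preceded by $k$ occurrences of $X$. Translation into LTL, with fresh variables $a,b$: $\lfloor\top\rfloor_{\mathrm{prop}}=\top$, $\lfloor p_k\rfloor_{\mathrm{prop}}=X^kp$, $\lfloor p_{\mathsf n+k}\rfloor_{\mathrm{prop}}=G(b\Rightarrow X^kp)$, $\lfloor p_{\mathsf i+k}\rfloor_{\mathrm{prop}}=X^kp$ ($\mathsf i\ne\mathsf n$), $\lfloor\neg s\rfloor_{\mathrm{prop}}=\neg\lfloor s\rfloor_{\mathrm{prop}}$, $\lfloor s_1\wedge s_2\rfloor_{\mathrm{prop}}=\lfloor s_1\rfloor_{\mathrm{prop}}\wedge\lfloor s_2\rfloor_{\mathrm{prop}}$, $\lfloor\bigwedge_{\mathsf i=0}^{\mathsf n-1}s\rfloor_{\mathrm{prop}}=G(a\Rightarrow\lfloor s\rfloor_{\mathrm{prop}})$;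 and $\lfloor s\rfloor=\lfloor s\rfloor_{\mathrm{prop}}\wedge(a\,U\,G\neg a)\wedge G((a\wedge\neg Xa)\Leftrightarrow Xb)\wedge(\neg a\Leftrightarrow b)$. -}

module Defs where

open import Data.Nat using (ℕ; zero; suc; _+_; _⊔_)

-- Schemata (restricted to the index shapes that may occur in an SPS)

PVar : Set
PVar = ℕ

-- Indices:  k ,  n + k ,  i + k   (n the parameter, i the iteration variable)
data Idx : Set where
  lit   : ℕ → Idx
  nPlus : ℕ → Idx
  iPlus : ℕ → Idx

data Schema : Set where
  ⊤ˢ    : Schema
  prop  : PVar → Idx → Schema
  ¬ˢ_   : Schema → Schema
  _∧ˢ_  : Schema → Schema → Schema
  ⋀ˢ    : Schema → Schema          -- ⋀_{i=0}^{n-1} s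

data InnerSPS : Schema → Set where
  top  : InnerSPS ⊤ˢ
  pvar : ∀ p k → InnerSPS (prop p (iPlus k))
  neg  : ∀ {s} → InnerSPS s → InnerSPS (¬ˢ s)
  conj : ∀ {s t} → InnerSPS s → InnerSPS t → InnerSPS (s ∧ˢ t)

data IsSPS : Schema → Set where
  top   : IsSPS ⊤ˢ
  pvarK : ∀ p k → IsSPS (prop p (lit k))
  pvarN : ∀ p k → IsSPS (prop p (nPlus k))
  neg   : ∀ {s} → IsSPS s → IsSPS (¬ˢ s)
  conj  : ∀ {s t} → IsSPS s → IsSPS t → IsSPS (s ∧ˢ t)
  iter  : ∀ {s} → InnerSPS s → IsSPS (⋀ˢ s)

-- Size (number of symbols) of a schema.  A numeral counts as one symbol.
idxSize : Idx → ℕ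
idxSize (lit k)   = 1
idxSize (nPlus k) = 3          -- n + k
idxSize (iPlus k) = 3          -- i + k

schemaSize : Schema → ℕ
schemaSize ⊤ˢ         = 1
schemaSize (prop p e) = 1 + idxSize e
schemaSize (¬ˢ s)     = 1 + schemaSize s
schemaSize (s ∧ˢ t)   = 1 + schemaSize s + schemaSize t
schemaSize (⋀ˢ s)     = 7 + schemaSize s   -- ⋀ , i , = , 0 , n , - , 1

-- N_s : the largest natural number occurring in s
-- (an iteration ⋀_{i=0}^{n-1} contributes the numerals 0 and 1).
idxNum : Idx → ℕ
idxNum (lit k)   = k
idxNum (nPlus k) = k
idxNum (iPlus k) = k

maxNum : Schema → ℕ
maxNum ⊤ˢ         = 0
maxNum (prop p e) = idxNum e
maxNum (¬ˢ s)     = maxNum s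
maxNum (s ∧ˢ t)   = maxNum s ⊔ maxNum t
maxNum (⋀ˢ s)     = 1 ⊔ maxNum s

data Atom : Set where
  var : PVar → Atom
  a   : Atom
  b   : Atom

data LTL : Set where
  ⊤ᴸ   : LTL
  atom : Atom → LTL
  ¬ᴸ_  : LTL → LTL
  _∧ᴸ_ : LTL → LTL → LTL
  X    : LTL → LTL
  _U_  : LTL → LTL → LTL

-- Abbreviations (expanded, so they count in the size)
G : LTL → LTL
G φ = ¬ᴸ (⊤ᴸ U (¬ᴸ φ))

_⇒ᴸ_ : LTL → LTL → LTL
φ ⇒ᴸ ψ = ¬ᴸ (φ ∧ᴸ (¬ᴸ ψ))

_⇔ᴸ_ : LTL → LTL → LTL
φ ⇔ᴸ ψ = (φ ⇒ᴸ ψ) ∧ᴸ (ψ ⇒ᴸ φ)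

X^ : ℕ → LTL → LTL
X^ zero    φ = φ
X^ (suc k) φ = X (X^ k φ)

ltlSize : LTL → ℕ
ltlSize ⊤ᴸ        = 1
ltlSize (atom x)  = 1
ltlSize (¬ᴸ φ)    = 1 + ltlSize φ
ltlSize (φ ∧ᴸ ψ)  = 1 + ltlSize φ + ltlSize ψ
ltlSize (X φ)     = 1 + ltlSize φ
ltlSize (φ U ψ)   = 1 + ltlSize φ + ltlSize ψ

aᴸ bᴸ : LTL
aᴸ = atom a
bᴸ = atom b

trProp : Schema → LTL
trProp ⊤ˢ                 = ⊤ᴸ
trProp (prop p (lit k))   = X^ k (atom (var p))
trProp (prop p (nPlus k)) = G (bᴸ ⇒ᴸ X^ k (atom (var p)))
trProp (prop p (iPlus k)) = X^ k (atom (var p))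
trProp (¬ˢ s)             = ¬ᴸ trProp s
trProp (s ∧ˢ t)           = trProp s ∧ᴸ trProp t
trProp (⋀ˢ s)             = G (aᴸ ⇒ᴸ trProp s)

translate : Schema → LTL
translate s =
  trProp s
  ∧ᴸ ((aᴸ U G (¬ᴸ aᴸ))
  ∧ᴸ (G ((aᴸ ∧ᴸ (¬ᴸ X aᴸ)) ⇔ᴸ X bᴸ)
  ∧ᴸ ((¬ᴸ aᴸ) ⇔ᴸ bᴸ)))

module Submission where

open import Defs
open import Data.Nat using (_*_; _≤_; _⊔_; suc; _+_; s≤s; z≤n)
open import Data.Nat.Properties
open import Data.Product using (∃-syntax; _,_)
open import Relation.Binary.PropositionalEquality
open import Algebra.Properties.CommutativeSemigroup *-commutativeSemigroup using (x∙yz≈y∙xz)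

-- Every schema symbol is translated into at most 9 + N LTL symbols: an index k becomes
-- the k operators of X^k, and each connective or iteration costs a constant.  Hence
-- #⌊s⌋_prop ≤ #s · (9 + N_s), and the fixed conjuncts of ⌊s⌋ add 49 ≤ 49 · #s · max(1, N_s).

ltlSize-X^ : ∀ k φ → ltlSize (X^ k φ) ≡ k + ltlSize φ
ltlSize-X^ 0       φ = refl
ltlSize-X^ (suc k) φ = cong suc (ltlSize-X^ k φ)

ltlSize-translate : ∀ s → ltlSize (translate s) ≡ ltlSize (trProp s) + 49
ltlSize-translate s = sym (+-suc (ltlSize (trProp s)) 48)

schemaSize-positive : ∀ s → 1 ≤ schemaSize s
schemaSize-positive ⊤ˢ         = s≤s z≤n
schemaSize-positive (prop p e) = s≤s z≤n
schemaSize-positive (¬ˢ s)     = s≤s z≤n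
schemaSize-positive (s ∧ˢ t)   = s≤s z≤n
schemaSize-positive (⋀ˢ s)     = s≤s z≤n

ltlSize-X^-var≤ : ∀ k p → ltlSize (X^ k (atom (var p))) ≤ 9 + k
ltlSize-X^-var≤ k p = begin
  ltlSize (X^ k (atom (var p))) ≡⟨ ltlSize-X^ k (atom (var p)) ⟩
  k + 1                         ≡⟨ +-comm k 1 ⟩
  1 + k                         ≤⟨ +-monoˡ-≤ k (s≤s z≤n) ⟩
  9 + k                         ∎
  where open ≤-Reasoning

ltlSize-trProp-prop≤ : ∀ p e → ltlSize (trProp (prop p e)) ≤ 9 + idxNum e
ltlSize-trProp-prop≤ p (lit k)   = ltlSize-X^-var≤ k p
ltlSize-trProp-prop≤ p (iPlus k) = ltlSize-X^-var≤ k p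
ltlSize-trProp-prop≤ p (nPlus k) = ≤-reflexive (cong (8 +_) (trans (ltlSize-X^ k _) (+-comm k 1)))

ltlSize-trProp≤ : ∀ {m} s → maxNum s ≤ m → ltlSize (trProp s) ≤ schemaSize s * (9 + m)
ltlSize-trProp≤ ⊤ˢ _ = s≤s z≤n
ltlSize-trProp≤ {m} (prop p e) e≤m =
  ≤-trans (≤-trans (ltlSize-trProp-prop≤ p e) (+-monoʳ-≤ 9 e≤m)) (m≤m+n (9 + m) _)
ltlSize-trProp≤ (¬ˢ s) s≤m = +-mono-≤ (s≤s z≤n) (ltlSize-trProp≤ s s≤m)
ltlSize-trProp≤ {m} (s ∧ˢ t) st≤m = begin
  1 + (ltlSize (trProp s) + ltlSize (trProp t))
    ≤⟨ +-mono-≤ 1≤B (+-mono-≤ (ltlSize-trProp≤ s (m⊔n≤o⇒m≤o _ _ st≤m))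
                                    (ltlSize-trProp≤ t (m⊔n≤o⇒n≤o _ _ st≤m))) ⟩
  B + (schemaSize s * B + schemaSize t * B)
    ≡⟨ cong (B +_) (sym (*-distribʳ-+ B (schemaSize s) (schemaSize t))) ⟩
  B + (schemaSize s + schemaSize t) * B
    ∎
  where
    open ≤-Reasoning
    B = 9 + m
    1≤B : 1 ≤ B
    1≤B = s≤s z≤n
ltlSize-trProp≤ {m} (⋀ˢ s) s≤m = begin
  8 + ltlSize (trProp s)     ≤⟨ +-mono-≤ (+-monoʳ-≤ 8 z≤n) (ltlSize-trProp≤ s (m⊔n≤o⇒n≤o 1 _ s≤m)) ⟩
  B + schemaSize s * B       ≤⟨ +-monoʳ-≤ B (*-monoˡ-≤ B (m≤n+m (schemaSize s) 6)) ⟩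
  B + (6 + schemaSize s) * B ∎
  where
    open ≤-Reasoning
    B = 9 + m

nine+n≤ten*[1⊔n] : ∀ n → 9 + n ≤ 10 * (1 ⊔ n)
nine+n≤ten*[1⊔n] n = begin
  9 + n                 ≡⟨ +-comm 9 n ⟩
  n + 9 * 1             ≤⟨ +-mono-≤ (m≤n⊔m 1 n) (*-monoʳ-≤ 9 (m≤m⊔n 1 n)) ⟩
  1 ⊔ n + 9 * (1 ⊔ n)   ∎
  where open ≤-Reasoning

mainTheorem5 : ∃[ C ] (∀ (s : Schema) → IsSPS s →
                 ltlSize (translate s) ≤ C * (schemaSize s * (1 ⊔ maxNum s)))
mainTheorem5 = 59 , λ s _ → bound s
  where
    bound : ∀ s → ltlSize (translate s) ≤ 59 * (schemaSize s * (1 ⊔ maxNum s))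
    bound s = begin
      ltlSize (translate s)       ≡⟨ ltlSize-translate s ⟩
      ltlSize (trProp s) + 49     ≤⟨ +-mono-≤ (ltlSize-trProp≤ s ≤-refl) (*-monoʳ-≤ 49 P-positive) ⟩
      S * (9 + N) + 49 * P        ≤⟨ +-monoˡ-≤ (49 * P) (*-monoʳ-≤ S (nine+n≤ten*[1⊔n] N)) ⟩
      S * (10 * (1 ⊔ N)) + 49 * P ≡⟨ cong (_+ 49 * P) (x∙yz≈y∙xz S 10 (1 ⊔ N)) ⟩
      10 * P + 49 * P             ≡⟨ sym (*-distribʳ-+ P 10 49) ⟩
      59 * P                      ∎
      where
        open ≤-Reasoning
        S = schemaSize s
        N = maxNum s
        P = S * (1 ⊔ N)
        P-positive : 1 ≤ P
        P-positive = *-mono-≤ (schemaSize-positive s) (m≤m⊔n 1 N)
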